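{- If $T$ is a nonempty $[t]$-unitrade, then $\langle T\rangle\setminus T$ is also a $[t]$-unitrade, where $\langle T\rangle$ denotes the affine span of $T$ in $\mathrm{GF}(2)^v$.
   Context: Let $V=\{1,\dots,v\}$; subsets of $V$ are identified with their characteristic vectors in $\mathrm{GF}(2)^v$. A $[t]$-unitrade is a set $T$ of subsets of $V$ such that every $S\subseteq V$ with $|S|\le t$ is contained in an even number of members of $T$. -}

module Defs where

open import Data.Nat using (ℕ; _≤_; _*_; suc)
open import Data.Bool using (Bool; _xor_)
open import Data.Vec using (zipWith)
open import Data.List using (List; length; foldr)
open import Data.List.Membership.Propositional using (_∈_)
open import Data.List.Relation.Unary.All using (All)
open import Data.List.Relation.Unary.Unique.Propositional using (Unique)
open import Data.Fin.Subset using (Subset; _⊆_; ∣_∣; ⊥)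
open import Data.Product using (Σ; _×_; ∃)
open import Function.Bundles using (_⇔_)
open import Relation.Binary.PropositionalEquality using (_≡_)
open import Relation.Nullary using (¬_)

-- Subsets of V = {1..v} are Fin-indexed Boolean vectors, i.e. vectors in GF(2)^v.
-- A set of subsets of V is a predicate on Subset v (automatically finite).
Family : ℕ → Set₁
Family v = Subset v → Set

_⊕_ : ∀ {v} → Subset v → Subset v → Subset v
_⊕_ = zipWith _xor_

sumL : ∀ {v} → List (Subset v) → Subset v
sumL = foldr _⊕_ ⊥

EvenlyMany : ∀ {v} → Family v → Set
EvenlyMany {v} Q =
  Σ (List (Subset v)) λ xs →
    Unique xs × (∀ X → (X ∈ xs) ⇔ Q X) × ∃ λ k → length xs ≡ 2 * k

Unitrade : ∀ {v} → ℕ → Family v → Set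
Unitrade t T = ∀ S → ∣ S ∣ ≤ t → EvenlyMany (λ X → T X × S ⊆ X)

-- affine span ⟨T⟩ in GF(2)^v: sums of an odd number of members of T
-- (affine combinations over GF(2); repetitions allowed, they cancel in pairs).
AffineSpan : ∀ {v} → Family v → Family v
AffineSpan {v} T X =
  Σ (List (Subset v)) λ xs →
    All T xs × (∃ λ k → length xs ≡ suc (2 * k)) × sumL xs ≡ X

SpanMinus : ∀ {v} → Family v → Family v
SpanMinus T X = AffineSpan T X × ¬ T X

Nonempty : ∀ {v} → Family v → Set
Nonempty {v} T = ∃ λ (X : Subset v) → T X

-- Counting modulo 2 over the cube GF(2)^v, a [t]-unitrade T is also even on
-- every subcube {X | X ∩ S = X₀ ∩ S} with |S| ≤ t, by induction on the
-- dimension.  Taking X₀ ∈ T, the subcube through X₀ holds a second member X₁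
-- of T.  The affine span ⟨T⟩ is invariant under translation by
-- d = X₀ ⊕ X₁ ≠ 0, and since d avoids S this translation pairs off the members
-- of ⟨T⟩ containing S, so these are evenly many.  Removing the evenly many
-- members of T containing S leaves evenly many members of ⟨T⟩ ∖ T.
module Submission where

open import Defs
open import Algebra.Bundles using (CommutativeRing)
open import Data.Bool using (Bool; true; false; not; _∧_; _xor_; if_then_else_; T)
import Data.Bool.Properties as Bool
open import Algebra.Properties.CommutativeSemigroup
  (CommutativeRing.+-commutativeSemigroup Bool.xor-∧-commutativeRing)
  using (interchange)
open import Data.Bool.Properties
  using (xor-assoc; xor-comm; xor-identityˡ; xor-identityʳ; xor-same;
         not-involutive; not-distribˡ-xor; ∧-distribʳ-xor; ∧-zeroʳ)
open import Data.Empty using (⊥-elim)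
open import Data.Fin.Subset using (Subset; _⊆_; ∣_∣; ⊥; ∁; inside; outside)
open import Data.Fin.Subset.Properties
  using (_⊆?_; ⊆-min; ∣⊥∣≡0; ∉⊥; x∉p⇒x∈∁p; out⊆; in⊆in; drop-∷-⊆)
open import Data.List using (List; []; _∷_; _++_; map; length)
open import Data.List.Properties using (length-++; length-map)
open import Data.List.Membership.Propositional using (_∈_)
open import Data.List.Membership.Propositional.Properties
  using (∈-map⁺; ∈-map⁻; ∈-++⁺ˡ; ∈-++⁺ʳ; ∈-++⁻)
open import Data.List.Membership.Propositional.Properties.WithK using (unique∧set⇒bag)
import Data.List.Membership.DecPropositional as DecMembership
open import Data.List.Relation.Binary.BagAndSetEquality using (∼bag⇒↭)
open import Data.List.Relation.Binary.Permutation.Propositional.Properties using (↭-length)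
open import Data.List.Relation.Unary.All as All using (All; []; _∷_)
open import Data.List.Relation.Unary.AllPairs using ([]; _∷_)
open import Data.List.Relation.Unary.Any using (here; there)
open import Data.List.Relation.Unary.Unique.Propositional using (Unique)
import Data.List.Relation.Unary.Unique.Propositional.Properties as Unique
open import Data.Nat using (ℕ; zero; suc; _+_; _*_; _≤_; z≤n; s≤s)
open import Data.Nat.Properties using (*-suc; m≤n⇒m≤1+n; even≢odd)
open import Data.Product using (Σ; _×_; ∃; _,_; proj₁)
import Data.Product.Properties as Product
open import Data.Sum using (inj₁; inj₂)
open import Data.Unit using (tt)
open import Data.Vec using ([]; _∷_; here)
import Data.Vec.Properties as Vec
open import Function using (_∘_)
open import Function.Bundles using (_⇔_; mk⇔; Equivalence)
import Function.Properties.Equivalence as ⇔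
open import Relation.Binary.Definitions using (DecidableEquality)
open import Relation.Binary.PropositionalEquality
open import Relation.Nullary using (Dec; yes; no; does; _×-dec_; ¬?)
import Relation.Nullary.Decidable as Dec
open import Relation.Unary using (Decidable)

open Equivalence using (to; from)
open ≡-Reasoning

⊕-assoc : ∀ {v} (X Y Z : Subset v) → (X ⊕ Y) ⊕ Z ≡ X ⊕ (Y ⊕ Z)
⊕-assoc = Vec.zipWith-assoc xor-assoc

⊕-comm : ∀ {v} (X Y : Subset v) → X ⊕ Y ≡ Y ⊕ X
⊕-comm = Vec.zipWith-comm xor-comm

⊕-identityˡ : ∀ {v} (X : Subset v) → ⊥ ⊕ X ≡ X
⊕-identityˡ = Vec.zipWith-identityˡ xor-identityˡ

⊕-identityʳ : ∀ {v} (X : Subset v) → X ⊕ ⊥ ≡ X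
⊕-identityʳ = Vec.zipWith-identityʳ xor-identityʳ

⊕-self : ∀ {v} (X : Subset v) → X ⊕ X ≡ ⊥
⊕-self []      = refl
⊕-self (x ∷ X) = cong₂ _∷_ (xor-same x) (⊕-self X)

⊕-cancelˡ : ∀ {v} (X Y : Subset v) → X ⊕ (X ⊕ Y) ≡ Y
⊕-cancelˡ X Y = begin
  X ⊕ (X ⊕ Y)  ≡⟨ ⊕-assoc X X Y ⟨
  (X ⊕ X) ⊕ Y  ≡⟨ cong (_⊕ Y) (⊕-self X) ⟩
  ⊥ ⊕ Y        ≡⟨ ⊕-identityˡ Y ⟩
  Y            ∎

⊕-swap : ∀ {v} (X Y Z : Subset v) → X ⊕ (Y ⊕ Z) ≡ Y ⊕ (X ⊕ Z)
⊕-swap X Y Z = begin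
  X ⊕ (Y ⊕ Z)  ≡⟨ ⊕-assoc X Y Z ⟨
  (X ⊕ Y) ⊕ Z  ≡⟨ cong (_⊕ Z) (⊕-comm X Y) ⟩
  (Y ⊕ X) ⊕ Z  ≡⟨ ⊕-assoc Y X Z ⟩
  Y ⊕ (X ⊕ Z)  ∎

⊕≡⊥⇒≡ : ∀ {v} {X Y : Subset v} → X ⊕ Y ≡ ⊥ → X ≡ Y
⊕≡⊥⇒≡ {X = X} {Y} X⊕Y≡⊥ = begin
  X            ≡⟨ ⊕-identityʳ X ⟨
  X ⊕ ⊥        ≡⟨ cong (X ⊕_) X⊕Y≡⊥ ⟨
  X ⊕ (X ⊕ Y)  ≡⟨ ⊕-cancelˡ X Y ⟩
  Y            ∎

⊆∁-⊕⁻ : ∀ {v} {S d X : Subset v} → S ⊆ ∁ d → S ⊆ d ⊕ X → S ⊆ X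
⊆∁-⊕⁻ {S = []} {[]} {[]} _ S⊆X = S⊆X
⊆∁-⊕⁻ {S = outside ∷ S} {_ ∷ d} {_ ∷ X} S⊆∁d S⊆d⊕X =
  out⊆ (⊆∁-⊕⁻ (drop-∷-⊆ S⊆∁d) (drop-∷-⊆ S⊆d⊕X))
⊆∁-⊕⁻ {S = inside ∷ S} {outside ∷ d} {inside ∷ X} S⊆∁d S⊆d⊕X =
  in⊆in (⊆∁-⊕⁻ (drop-∷-⊆ S⊆∁d) (drop-∷-⊆ S⊆d⊕X))
⊆∁-⊕⁻ {S = inside ∷ S} {outside ∷ d} {outside ∷ X} _ S⊆d⊕X with S⊆d⊕X here
... | ()
⊆∁-⊕⁻ {S = inside ∷ S} {inside ∷ d} S⊆∁d _ with S⊆∁d here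
... | ()

⊆∁-⊕⇔ : ∀ {v} {S d X : Subset v} → S ⊆ ∁ d → (S ⊆ d ⊕ X) ⇔ (S ⊆ X)
⊆∁-⊕⇔ {S = S} {d} {X} S⊆∁d = mk⇔ (⊆∁-⊕⁻ S⊆∁d)
  (λ S⊆X → ⊆∁-⊕⁻ S⊆∁d (subst (S ⊆_) (sym (⊕-cancelˡ d X)) S⊆X))

⊆∁-⊕-self : ∀ {v} (S X : Subset v) → S ⊆ ∁ (X ⊕ X)
⊆∁-⊕-self S X = subst (λ Z → S ⊆ ∁ Z) (sym (⊕-self X)) (λ _ → x∉p⇒x∈∁p ∉⊥)

parity : ∀ {v} → (Subset v → Bool) → Bool
parity {zero}  f = f []
parity {suc v} f = parity (λ X → f (outside ∷ X)) xor parity (λ X → f (inside ∷ X))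

parity-cong : ∀ {v} {f g : Subset v → Bool} → (∀ X → f X ≡ g X) → parity f ≡ parity g
parity-cong {zero}  f≗g = f≗g []
parity-cong {suc v} f≗g =
  cong₂ _xor_ (parity-cong (f≗g ∘ (outside ∷_))) (parity-cong (f≗g ∘ (inside ∷_)))

parity-false : ∀ {v} → parity {v} (λ _ → false) ≡ false
parity-false {zero}  = refl
parity-false {suc v} = cong₂ _xor_ (parity-false {v}) (parity-false {v})

parity-∧-false : ∀ {v} (f : Subset v → Bool) → parity (λ X → f X ∧ false) ≡ false
parity-∧-false {v} f = trans (parity-cong (λ X → ∧-zeroʳ (f X))) (parity-false {v})

parity-xor : ∀ {v} (f g : Subset v → Bool) →
  parity (λ X → f X xor g X) ≡ parity f xor parity g
parity-xor {zero}  f g = refl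
parity-xor {suc v} f g = trans
  (cong₂ _xor_ (parity-xor (λ X → f (outside ∷ X)) (λ X → g (outside ∷ X)))
               (parity-xor (λ X → f (inside ∷ X)) (λ X → g (inside ∷ X))))
  (interchange (parity (λ X → f (outside ∷ X))) (parity (λ X → g (outside ∷ X)))
               (parity (λ X → f (inside ∷ X))) (parity (λ X → g (inside ∷ X))))

parity-∧-distribʳ-xor : ∀ {v} (f g h : Subset v → Bool) →
  parity (λ X → (f X xor g X) ∧ h X)
    ≡ parity (λ X → f X ∧ h X) xor parity (λ X → g X ∧ h X)
parity-∧-distribʳ-xor f g h =
  trans (parity-cong (λ X → ∧-distribʳ-xor (h X) (f X) (g X)))
        (parity-xor (λ X → f X ∧ h X) (λ X → g X ∧ h X))

parity-translate : ∀ {v} (d : Subset v) (f : Subset v → Bool) →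
  parity (λ X → f (d ⊕ X)) ≡ parity f
parity-translate []            f = refl
parity-translate (outside ∷ d) f = cong₂ _xor_
  (parity-translate d (λ X → f (outside ∷ X))) (parity-translate d (λ X → f (inside ∷ X)))
parity-translate (inside ∷ d)  f = trans
  (cong₂ _xor_ (parity-translate d (λ X → f (inside ∷ X)))
               (parity-translate d (λ X → f (outside ∷ X))))
  (xor-comm (parity (λ X → f (inside ∷ X))) (parity (λ X → f (outside ∷ X))))

parity-translation-invariant : ∀ {v} {d : Subset v} (f : Subset v → Bool) →
  d ≢ ⊥ → (∀ X → f (d ⊕ X) ≡ f X) → parity f ≡ false
parity-translation-invariant {d = []} f d≢⊥ _ = ⊥-elim (d≢⊥ refl)
parity-translation-invariant {d = outside ∷ d} f d≢⊥ invariant = cong₂ _xor_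
  (parity-translation-invariant _ (d≢⊥ ∘ cong (outside ∷_)) (invariant ∘ (outside ∷_)))
  (parity-translation-invariant _ (d≢⊥ ∘ cong (outside ∷_)) (invariant ∘ (inside ∷_)))
parity-translation-invariant {d = inside ∷ d} f _ invariant = begin
  parity f₀ xor parity f₁                   ≡⟨ cong (_xor parity f₁) f₀≡f₁ ⟩
  parity f₁ xor parity f₁                   ≡⟨ xor-same (parity f₁) ⟩
  false                                     ∎
  where
  f₀ f₁ : Subset _ → Bool
  f₀ X = f (outside ∷ X)
  f₁ X = f (inside ∷ X)
  f₀≡f₁ : parity f₀ ≡ parity f₁
  f₀≡f₁ = trans (sym (parity-cong (invariant ∘ (outside ∷_)))) (parity-translate d f₁)

∧-not-distribʳ-xor : ∀ a b c → (T b → T a) → (a ∧ not b) ∧ c ≡ (a ∧ c) xor (b ∧ c)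
∧-not-distribʳ-xor false false c     _   = refl
∧-not-distribʳ-xor false true  c     b⇒a = ⊥-elim (b⇒a tt)
∧-not-distribʳ-xor true  false false _   = refl
∧-not-distribʳ-xor true  false true  _   = refl
∧-not-distribʳ-xor true  true  false _   = refl
∧-not-distribʳ-xor true  true  true  _   = refl

parity-∧-not : ∀ {v} (f g h : Subset v → Bool) → (∀ X → T (g X) → T (f X)) →
  parity (λ X → (f X ∧ not (g X)) ∧ h X)
    ≡ parity (λ X → f X ∧ h X) xor parity (λ X → g X ∧ h X)
parity-∧-not f g h g⇒f =
  trans (parity-cong (λ X → ∧-not-distribʳ-xor (f X) (g X) (h X) (g⇒f X)))
        (parity-xor (λ X → f X ∧ h X) (λ X → g X ∧ h X))

isOdd : ℕ → Bool
isOdd zero    = false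
isOdd (suc n) = not (isOdd n)

isOdd-+ : ∀ m n → isOdd (m + n) ≡ isOdd m xor isOdd n
isOdd-+ zero    n = refl
isOdd-+ (suc m) n = trans (cong not (isOdd-+ m n)) (not-distribˡ-xor (isOdd m) (isOdd n))

isOdd-2* : ∀ k → isOdd (2 * k) ≡ false
isOdd-2* zero    = refl
isOdd-2* (suc k) =
  trans (cong isOdd (*-suc 2 k)) (trans (not-involutive (isOdd (2 * k))) (isOdd-2* k))

isOdd≡false⇒even : ∀ n → isOdd n ≡ false → ∃ λ k → n ≡ 2 * k
isOdd≡true⇒odd : ∀ n → isOdd n ≡ true → ∃ λ k → n ≡ suc (2 * k)

isOdd≡false⇒even zero    _ = 0 , refl
isOdd≡false⇒even (suc n) e =
  let k , n≡1+2k = isOdd≡true⇒odd n (trans (sym (not-involutive (isOdd n))) (cong not e))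
  in suc k , trans (cong suc n≡1+2k) (sym (*-suc 2 k))

isOdd≡true⇒odd zero    ()
isOdd≡true⇒odd (suc n) e =
  let k , n≡2k = isOdd≡false⇒even n (trans (sym (not-involutive (isOdd n))) (cong not e))
  in k , cong suc n≡2k

enumerate : ∀ {v} → (Subset v → Bool) → List (Subset v)
enumerate {zero}  f = if f [] then [] ∷ [] else []
enumerate {suc v} f = map (outside ∷_) (enumerate (λ X → f (outside ∷ X)))
                   ++ map (inside ∷_) (enumerate (λ X → f (inside ∷ X)))

∈-enumerate⁺ : ∀ {v} {f : Subset v → Bool} {X} → T (f X) → X ∈ enumerate f
∈-enumerate⁺ {zero} {f} {[]} fX with f []
... | true = here refl
∈-enumerate⁺ {suc v} {f} {outside ∷ X} fX =
  ∈-++⁺ˡ (∈-map⁺ (outside ∷_) (∈-enumerate⁺ fX))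
∈-enumerate⁺ {suc v} {f} {inside ∷ X}  fX =
  ∈-++⁺ʳ _ (∈-map⁺ (inside ∷_) (∈-enumerate⁺ fX))

∈-enumerate⁻ : ∀ {v} {f : Subset v → Bool} {X} → X ∈ enumerate f → T (f X)
∈-enumerate⁻ {zero} {f} {[]} X∈ with f []
∈-enumerate⁻ {zero} {f} {[]} (here refl) | true = tt
∈-enumerate⁻ {suc v} {f} X∈
  with ∈-++⁻ (map (outside ∷_) (enumerate (λ X → f (outside ∷ X)))) X∈
... | inj₁ X∈₀ with ∈-map⁻ (outside ∷_) X∈₀
...   | _ , Y∈ , refl = ∈-enumerate⁻ Y∈
∈-enumerate⁻ {suc v} {f} X∈ | inj₂ X∈₁ with ∈-map⁻ (inside ∷_) X∈₁
...   | _ , Y∈ , refl = ∈-enumerate⁻ Y∈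

enumerate-unique : ∀ {v} (f : Subset v → Bool) → Unique (enumerate f)
enumerate-unique {zero} f with f []
... | true  = [] ∷ []
... | false = []
enumerate-unique {suc v} f = Unique.++⁺
  (Unique.map⁺ Vec.∷-injectiveʳ (enumerate-unique (λ X → f (outside ∷ X))))
  (Unique.map⁺ Vec.∷-injectiveʳ (enumerate-unique (λ X → f (inside ∷ X))))
  λ (X∈₀ , X∈₁) →
    let _ , _ , X≡outside∷ = ∈-map⁻ (outside ∷_) X∈₀
        _ , _ , X≡inside∷ = ∈-map⁻ (inside ∷_) X∈₁
    in outside≢inside (trans (sym X≡outside∷) X≡inside∷)
  where
  outside≢inside : ∀ {Y Z : Subset v} → outside ∷ Y ≢ inside ∷ Z
  outside≢inside ()

isOdd-length-enumerate : ∀ {v} (f : Subset v → Bool) →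
  isOdd (length (enumerate f)) ≡ parity f
isOdd-length-enumerate {zero} f with f []
... | true  = refl
... | false = refl
isOdd-length-enumerate {suc v} f = begin
  isOdd (length (map (outside ∷_) E₀ ++ map (inside ∷_) E₁))
    ≡⟨ cong isOdd (length-++ (map (outside ∷_) E₀)) ⟩
  isOdd (length (map (outside ∷_) E₀) + length (map (inside ∷_) E₁))
    ≡⟨ isOdd-+ (length (map (outside ∷_) E₀)) (length (map (inside ∷_) E₁)) ⟩
  isOdd (length (map (outside ∷_) E₀)) xor isOdd (length (map (inside ∷_) E₁))
    ≡⟨ cong₂ (λ m n → isOdd m xor isOdd n)
             (length-map (outside ∷_) E₀) (length-map (inside ∷_) E₁) ⟩
  isOdd (length E₀) xor isOdd (length E₁)
    ≡⟨ cong₂ _xor_ (isOdd-length-enumerate (λ X → f (outside ∷ X)))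
                   (isOdd-length-enumerate (λ X → f (inside ∷ X))) ⟩
  parity f
    ∎
  where
  E₀ E₁ : List (Subset v)
  E₀ = enumerate (λ X → f (outside ∷ X))
  E₁ = enumerate (λ X → f (inside ∷ X))

T-does : ∀ {A : Set} (a? : Dec A) → T (does a?) ⇔ A
T-does (yes a)  = mk⇔ (λ _ → a) (λ _ → tt)
T-does (no ¬a) = mk⇔ (λ ()) ¬a

length-unique-≡ : ∀ {A : Set} {xs ys : List A} → Unique xs → Unique ys →
  (∀ {x} → x ∈ xs ⇔ x ∈ ys) → length xs ≡ length ys
length-unique-≡ xs! ys! xs≈ys = ↭-length (∼bag⇒↭ (unique∧set⇒bag xs! ys! xs≈ys))

module _ {v} {P : Family v} (P? : Decidable P) where

  ∈-enumerate-does : ∀ X → X ∈ enumerate (does ∘ P?) ⇔ P X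
  ∈-enumerate-does X =
    mk⇔ (to (T-does (P? X)) ∘ ∈-enumerate⁻) (∈-enumerate⁺ ∘ from (T-does (P? X)))

  parity≡false⇒EvenlyMany : parity (does ∘ P?) ≡ false → EvenlyMany P
  parity≡false⇒EvenlyMany even =
    enumerate (does ∘ P?) , enumerate-unique (does ∘ P?) , ∈-enumerate-does ,
    isOdd≡false⇒even _ (trans (isOdd-length-enumerate (does ∘ P?)) even)

  EvenlyMany⇒parity≡false : EvenlyMany P → parity (does ∘ P?) ≡ false
  EvenlyMany⇒parity≡false (xs , xs! , xs⇔P , k , ∣xs∣≡2k) = begin
    parity (does ∘ P?)                   ≡⟨ isOdd-length-enumerate (does ∘ P?) ⟨
    isOdd (length (enumerate (does ∘ P?)))
      ≡⟨ cong isOdd (length-unique-≡ (enumerate-unique (does ∘ P?)) xs! same) ⟩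
    isOdd (length xs)                    ≡⟨ cong isOdd ∣xs∣≡2k ⟩
    isOdd (2 * k)                        ≡⟨ isOdd-2* k ⟩
    false                                ∎
    where
    same : ∀ {X} → X ∈ enumerate (does ∘ P?) ⇔ X ∈ xs
    same {X} = ⇔.trans (∈-enumerate-does X) (⇔.sym (xs⇔P X))

∃-distinct-member : ∀ {A : Set} {xs : List A} {x : A} {k} →
  Unique xs → length xs ≡ 2 * k → x ∈ xs → ∃ λ y → y ∈ xs × y ≢ x
∃-distinct-member {xs = _ ∷ []} {k = k} _ ∣xs∣≡2k _ =
  ⊥-elim (even≢odd k 0 (sym ∣xs∣≡2k))
∃-distinct-member {xs = y ∷ z ∷ _} (y≢ ∷ _) _ (here refl) =
  z , there (here refl) , (All.head y≢ ∘ sym)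
∃-distinct-member {xs = y ∷ z ∷ _} (y≢ ∷ _) _ (there x∈) =
  y , here refl , All.lookup y≢ x∈

_≟ˢ_ : ∀ {v} → DecidableEquality (Subset v)
_≟ˢ_ = Vec.≡-dec Bool._≟_

enumerated? : ∀ {v} {T : Family v} (L : List (Subset v)) →
  (∀ X → X ∈ L ⇔ T X) → Decidable T
enumerated? L L⇔T X = Dec.map (L⇔T X) (X ∈? L)
  where open DecMembership _≟ˢ_ using (_∈?_)

module _ {v : ℕ} where

  toggle : Subset v → Subset v × Bool → Subset v × Bool
  toggle Y (X , b) = Y ⊕ X , not b

  -- All pairs (sum of xs, parity of length xs) for lists xs of elements of L;
  -- repetitions cancel in pairs, so sublists of L suffice.
  subsetSums : List (Subset v) → List (Subset v × Bool)
  subsetSums []      = (⊥ , false) ∷ []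
  subsetSums (Y ∷ L) = subsetSums L ++ map (toggle Y) (subsetSums L)

  subsetSums-sound : ∀ L {X b} → (X , b) ∈ subsetSums L →
    ∃ λ xs → All (_∈ L) xs × isOdd (length xs) ≡ b × sumL xs ≡ X
  subsetSums-sound [] (here refl) = [] , [] , refl , refl
  subsetSums-sound (Y ∷ L) q∈ with ∈-++⁻ (subsetSums L) q∈
  ... | inj₁ q∈L =
    let xs , xs⊆L , odd , Σxs = subsetSums-sound L q∈L
    in xs , All.map there xs⊆L , odd , Σxs
  ... | inj₂ q∈YL with ∈-map⁻ (toggle Y) q∈YL
  ...   | _ , q′∈L , refl =
    let xs , xs⊆L , odd , Σxs = subsetSums-sound L q′∈L
    in Y ∷ xs , here refl ∷ All.map there xs⊆L , cong not odd , cong (Y ⊕_) Σxs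

  subsetSums-zero : ∀ L → (⊥ , false) ∈ subsetSums L
  subsetSums-zero []      = here refl
  subsetSums-zero (_ ∷ L) = ∈-++⁺ˡ (subsetSums-zero L)

  subsetSums-toggle : ∀ L {Y q} → Y ∈ L → q ∈ subsetSums L → toggle Y q ∈ subsetSums L
  subsetSums-toggle (Z ∷ L) {Y} {q} Y∈ q∈ with ∈-++⁻ (subsetSums L) q∈ | Y∈
  ... | inj₁ q∈L | here refl  = ∈-++⁺ʳ (subsetSums L) (∈-map⁺ (toggle Z) q∈L)
  ... | inj₁ q∈L | there Y∈L = ∈-++⁺ˡ (subsetSums-toggle L Y∈L q∈L)
  ... | inj₂ q∈ZL | Y∈′ with ∈-map⁻ (toggle Z) q∈ZL
  ...   | (X , b) , q′∈L , refl with Y∈′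
  ...     | here refl = ∈-++⁺ˡ
    (subst (_∈ subsetSums L) (sym (cong₂ _,_ (⊕-cancelˡ Z X) (not-involutive b))) q′∈L)
  ...     | there Y∈L = ∈-++⁺ʳ (subsetSums L)
    (subst (_∈ map (toggle Z) (subsetSums L)) (cong (_, not (not b)) (⊕-swap Z Y X))
      (∈-map⁺ (toggle Z) (subsetSums-toggle L Y∈L q′∈L)))

  subsetSums-complete : ∀ L xs → All (_∈ L) xs →
    (sumL xs , isOdd (length xs)) ∈ subsetSums L
  subsetSums-complete L []       []          = subsetSums-zero L
  subsetSums-complete L (_ ∷ xs) (x∈ ∷ xs⊆L) =
    subsetSums-toggle L x∈ (subsetSums-complete L xs xs⊆L)

affineSpan? : ∀ {v} {T : Family v} (L : List (Subset v)) →
  (∀ X → X ∈ L ⇔ T X) → Decidable (AffineSpan T)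
affineSpan? {T = T} L L⇔T X = Dec.map′ sound complete ((X , true) ∈? subsetSums L)
  where
  open DecMembership (Product.≡-dec _≟ˢ_ Bool._≟_) using (_∈?_)
  sound : (X , true) ∈ subsetSums L → AffineSpan T X
  sound q∈ =
    let xs , xs⊆L , odd , Σxs = subsetSums-sound L q∈
    in xs , All.map (to (L⇔T _)) xs⊆L , isOdd≡true⇒odd _ odd , Σxs
  complete : AffineSpan T X → (X , true) ∈ subsetSums L
  complete (xs , Txs , (k , ∣xs∣≡1+2k) , Σxs) =
    subst (_∈ subsetSums L) (cong₂ _,_ Σxs odd)
      (subsetSums-complete L xs (All.map (from (L⇔T _)) Txs))
    where
    odd : isOdd (length xs) ≡ true
    odd = trans (cong isOdd ∣xs∣≡1+2k) (cong not (isOdd-2* k))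

Unitrade⇒enumeration : ∀ {v t} {T : Family v} → Unitrade t T →
  Σ (List (Subset v)) λ L → ∀ X → X ∈ L ⇔ T X
Unitrade⇒enumeration {v} {t} unitrade =
  let L , _ , L⇔ , _ = unitrade ⊥ (subst (_≤ t) (sym (∣⊥∣≡0 v)) z≤n)
  in L , λ X → mk⇔ (proj₁ ∘ to (L⇔ X)) (λ TX → from (L⇔ X) (TX , ⊆-min X))

T⊆AffineSpan : ∀ {v} {T : Family v} {X} → T X → AffineSpan T X
T⊆AffineSpan {X = X} TX = X ∷ [] , TX ∷ [] , (0 , refl) , ⊕-identityʳ X

AffineSpan-translate : ∀ {v} {T : Family v} {X₀ X₁ X} → T X₀ → T X₁ →
  AffineSpan T X → AffineSpan T ((X₀ ⊕ X₁) ⊕ X)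
AffineSpan-translate {X₀ = X₀} {X₁} {X} TX₀ TX₁ (xs , Txs , (k , ∣xs∣≡1+2k) , Σxs≡X) =
  X₀ ∷ X₁ ∷ xs , TX₀ ∷ TX₁ ∷ Txs ,
  (suc k , cong suc (trans (cong suc ∣xs∣≡1+2k) (sym (*-suc 2 k)))) ,
  trans (cong (λ Z → X₀ ⊕ (X₁ ⊕ Z)) Σxs≡X) (sym (⊕-assoc X₀ X₁ X))

AffineSpan-translate-⇔ : ∀ {v} {T : Family v} {X₀ X₁ X} → T X₀ → T X₁ →
  AffineSpan T ((X₀ ⊕ X₁) ⊕ X) ⇔ AffineSpan T X
AffineSpan-translate-⇔ {T = T} {X₀} {X₁} {X} TX₀ TX₁ = mk⇔
  (subst (AffineSpan T) (⊕-cancelˡ (X₀ ⊕ X₁) X) ∘ AffineSpan-translate TX₀ TX₁)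
  (AffineSpan-translate TX₀ TX₁)

_⊆ᵇ_ : ∀ {v} → Subset v → Subset v → Bool
S ⊆ᵇ X = does (S ⊆? X)

Balanced : ∀ {v} → ℕ → (Subset v → Bool) → Set
Balanced t f = ∀ U → ∣ U ∣ ≤ t → parity (λ X → f X ∧ U ⊆ᵇ X) ≡ false

Unitrade⇒Balanced : ∀ {v t} {T : Family v} → Unitrade t T → (T? : Decidable T) →
  Balanced t (λ X → does (T? X))
Unitrade⇒Balanced unitrade T? U ∣U∣≤t =
  EvenlyMany⇒parity≡false (λ X → T? X ×-dec U ⊆? X) (unitrade U ∣U∣≤t)

Balanced-xor-halves : ∀ {v t} (f : Subset (suc v) → Bool) → Balanced t f →
  Balanced t (λ X → f (outside ∷ X) xor f (inside ∷ X))
Balanced-xor-halves f balanced U ∣U∣≤t =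
  trans (parity-∧-distribʳ-xor (λ X → f (outside ∷ X)) (λ X → f (inside ∷ X)) (U ⊆ᵇ_))
        (balanced (outside ∷ U) ∣U∣≤t)

Balanced-inside-half : ∀ {v t} (f : Subset (suc v) → Bool) → Balanced (suc t) f →
  Balanced t (λ X → f (inside ∷ X))
Balanced-inside-half f balanced U ∣U∣≤t =
  trans (cong (_xor parity (λ X → f (inside ∷ X) ∧ U ⊆ᵇ X))
              (sym (parity-∧-false (λ X → f (outside ∷ X)))))
        (balanced (inside ∷ U) (s≤s ∣U∣≤t))

-- S ⊆ ∁ (P ⊕ X) says that X agrees with P on S.
Balanced-subcube : ∀ {v t} (f : Subset v → Bool) → Balanced t f →
  ∀ S → ∣ S ∣ ≤ t → ∀ P → parity (λ X → f X ∧ S ⊆ᵇ ∁ (P ⊕ X)) ≡ false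
Balanced-subcube {zero} f balanced [] _ [] = balanced [] z≤n
Balanced-subcube {suc v} f balanced (outside ∷ S) ∣S∣≤t (_ ∷ P) =
  trans (sym (parity-∧-distribʳ-xor (λ X → f (outside ∷ X)) (λ X → f (inside ∷ X))
                                    (λ X → S ⊆ᵇ ∁ (P ⊕ X))))
        (Balanced-subcube _ (Balanced-xor-halves f balanced) S ∣S∣≤t P)
Balanced-subcube {suc v} {suc t} f balanced (inside ∷ S) (s≤s ∣S∣≤t) (inside ∷ P) =
  trans (cong (_xor parity (λ X → f (inside ∷ X) ∧ S ⊆ᵇ ∁ (P ⊕ X)))
              (parity-∧-false (λ X → f (outside ∷ X))))
        (Balanced-subcube _ (Balanced-inside-half f balanced) S ∣S∣≤t P)
Balanced-subcube {suc v} {suc t} f balanced (inside ∷ S) (s≤s ∣S∣≤t) (outside ∷ P) =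
  begin
    parity (λ X → f₀ X ∧ A X) xor parity (λ X → f₁ X ∧ false)
      ≡⟨ cong (parity (λ X → f₀ X ∧ A X) xor_)
              (trans (parity-∧-false f₁) (sym f₁-even)) ⟩
    parity (λ X → f₀ X ∧ A X) xor parity (λ X → f₁ X ∧ A X)
      ≡⟨ parity-∧-distribʳ-xor f₀ f₁ A ⟨
    parity (λ X → (f₀ X xor f₁ X) ∧ A X)
      ≡⟨ Balanced-subcube _ (Balanced-xor-halves f balanced) S (m≤n⇒m≤1+n ∣S∣≤t) P ⟩
    false
      ∎
  where
  f₀ f₁ A : Subset v → Bool
  f₀ X = f (outside ∷ X)
  f₁ X = f (inside ∷ X)
  A X = S ⊆ᵇ ∁ (P ⊕ X)
  f₁-even : parity (λ X → f₁ X ∧ A X) ≡ false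
  f₁-even = Balanced-subcube _ (Balanced-inside-half f balanced) S ∣S∣≤t P

subcube-neighbour : ∀ {v t} {T : Family v} (T? : Decidable T) →
  Balanced t (λ X → does (T? X)) → ∀ {S X₀} → ∣ S ∣ ≤ t → T X₀ →
  ∃ λ X₁ → T X₁ × X₁ ≢ X₀ × S ⊆ ∁ (X₀ ⊕ X₁)
subcube-neighbour T? balanced {S} {X₀} ∣S∣≤t TX₀ =
  let xs , xs! , xs⇔ , k , ∣xs∣≡2k = parity≡false⇒EvenlyMany
        (λ X → T? X ×-dec S ⊆? ∁ (X₀ ⊕ X)) (Balanced-subcube _ balanced S ∣S∣≤t X₀)
      X₁ , X₁∈ , X₁≢X₀ =
        ∃-distinct-member {k = k} xs! ∣xs∣≡2k (from (xs⇔ X₀) (TX₀ , ⊆∁-⊕-self S X₀))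
      TX₁ , S⊆∁d = to (xs⇔ X₁) X₁∈
  in X₁ , TX₁ , X₁≢X₀ , S⊆∁d

AffineSpan-even : ∀ {v} {T : Family v} (span? : Decidable (AffineSpan T)) {S X₀ X₁} →
  T X₀ → T X₁ → X₁ ≢ X₀ → S ⊆ ∁ (X₀ ⊕ X₁) →
  parity (λ X → does (span? X) ∧ S ⊆ᵇ X) ≡ false
AffineSpan-even span? {S} {X₀} {X₁} TX₀ TX₁ X₁≢X₀ S⊆∁d =
  parity-translation-invariant _ (X₁≢X₀ ∘ sym ∘ ⊕≡⊥⇒≡) λ X → cong₂ _∧_
    (Dec.does-⇔ (AffineSpan-translate-⇔ TX₀ TX₁) (span? _) (span? X))
    (Dec.does-⇔ (⊆∁-⊕⇔ S⊆∁d) (S ⊆? _) (S ⊆? X))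

lemma3p16 : (v t : ℕ) (T : Family v) →
    Nonempty T → Unitrade t T → Unitrade t (SpanMinus T)
lemma3p16 v t T (X₀ , TX₀) unitrade S ∣S∣≤t =
  let L , L⇔T = Unitrade⇒enumeration unitrade
      T? = enumerated? L L⇔T
      span? = affineSpan? L L⇔T
      balanced = Unitrade⇒Balanced unitrade T?
      X₁ , TX₁ , X₁≢X₀ , S⊆∁d = subcube-neighbour T? balanced ∣S∣≤t TX₀
  in parity≡false⇒EvenlyMany (λ X → (span? X ×-dec ¬? (T? X)) ×-dec S ⊆? X) (begin
    parity (λ X → (does (span? X) ∧ not (does (T? X))) ∧ S ⊆ᵇ X)
      ≡⟨ parity-∧-not _ _ _ (λ X →
           from (T-does (span? X)) ∘ T⊆AffineSpan ∘ to (T-does (T? X))) ⟩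
    parity (λ X → does (span? X) ∧ S ⊆ᵇ X) xor parity (λ X → does (T? X) ∧ S ⊆ᵇ X)
      ≡⟨ cong₂ _xor_ (AffineSpan-even span? {S} TX₀ TX₁ X₁≢X₀ S⊆∁d)
                     (balanced S ∣S∣≤t) ⟩
    false
      ∎)
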